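{- For a heap with exponential upper bounded sets containing $n$ elements (built by a sequence of the operations Insert, Delete-Min, Decrease-Key starting from the empty heap), the number of sets satisfies $\ell\le 1+\lg n$.
   Context: $\lg$ is the binary logarithm. Keys are distinct and totally ordered. A heap with exponential upper bounded sets consists of sets $S_1,\ldots,S_\ell$ (doubly-linked lists with stored sizes) and pivots $p_2\le\cdots\le p_\ell$ ($p_1=-\infty$, $p_{\ell+1}=+\infty$) with $S_i\subseteq[p_i,p_{i+1})$, satisfying $|S_i|<3\cdot2^i$; sets may be empty. Insert$(e)$: binary search the pivots for $i$ with $p_i\le e<p_{i+1}$, append $e$ to $S_i$; if $|S_i|=3\cdot2^i$, push all elements of $S_i$ to $S_{i+1}$ and set $S_i=\emptyset$. A (recursive) push of a set $X$ to $S_j$ (where $2^{j-1}\le|X|\le 3\cdot 2^{j-1}$): if $j=\ell+1$, create $S_{\ell+1}=X$ and increase $\ell$; else if $|S_j|<2^j$, concatenate $X$ to $S_j$ and stop; otherwise $X$ becomes $S_j$ and the old $S_j$ is recursively pushed to $S_{j+1}$. Delete-Min: if $S_1$ is empty, first recursively pull elements into $S_1$; delete and return the minimum of $S_1$; then if $\ell>1+\lg n$ ($n$ the new number of elements), concatenate $S_{\ell-1}$ and $S_\ell$, discard $S_\ell$ and $p_\ell$. A pull into an empty $S_i$: if $S_{i+1}$ is empty, first recursively pull into $S_{i+1}$; then if $|S_{i+1}|\le2^{i-1}$ move all of $S_{i+1}$ to $S_i$, else move the $2^{i-1}$ smallest elements of $S_{i+1}$ into $S_i$ and update $p_{i+1}$.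 Decrease-Key$(ptr,key)$: remove the element from its set, change its key, append it to the set whose pivot range contains the new key, and if that set $S_i$ reaches size $3\cdot2^i$ push it to $S_{i+1}$. -}

module Defs where

open import Data.Nat using (ℕ; zero; suc; _+_; _*_; _∸_; _^_; _≤_; _<_)
open import Data.Nat.Logarithm using (⌊log₂_⌋)
open import Data.Product using (_×_; _,_)
open import Data.Unit using (⊤)
open import Data.List using (List; []; _∷_; _++_; [_]; length; filter; map; concat; sum)
open import Data.List.Membership.Propositional using (_∈_; _∉_)
open import Data.List.Relation.Unary.All using (All)
open import Data.List.Relation.Binary.Permutation.Propositional using (_↭_)
open import Relation.Nullary using (¬_; ¬?)
open import Relation.Binary.PropositionalEquality using (_≡_)
import Data.Nat as ℕ

Key : Set
Key = ℕ

-- A block (p_i , S_i): the pivot p_i and the set S_i (a list of keys).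
-- The first block's pivot p_1 = -∞ is represented by 0 (all keys are ≥ 0).
Block : Set
Block = Key × List Key

Heap : Set
Heap = List Block

emptyHeap : Heap
emptyHeap = (0 , []) ∷ []

numSets : Heap → ℕ
numSets = length

keys : Heap → List Key
keys h = concat (map (λ b → Data.Product.proj₂ b) h)
  where import Data.Product

size : Heap → ℕ
size h = length (keys h)

-- remove one key from a list (keys are distinct)
removeK : Key → List Key → List Key
removeK e = filter (λ x → ¬? (x ℕ.≟ e))

removeKey : Key → Heap → Heap
removeKey e = map (λ { (p , S) → (p , removeK e S) })

-- e < p_{i+1} where the argument is the suffix of blocks after S_i
-- (p_{ℓ+1} = +∞).
Below : Key → Heap → Set
Below e [] = ⊤
Below e ((q , _) ∷ _) = e < q

-- Push j X bs bs' : push the set X (carrying its lower pivot) to S_j,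
-- where bs is the suffix of the heap starting at position j.
data Push : ℕ → Block → Heap → Heap → Set where
  push-new  : ∀ {j X} → Push j X [] (X ∷ [])
  push-cat  : ∀ {j q X p S bs} → length S < 2 ^ j →
              Push j (q , X) ((p , S) ∷ bs) ((q , X ++ S) ∷ bs)
  push-casc : ∀ {j q X p S bs bs'} → 2 ^ j ≤ length S →
              Push (suc j) (p , S) bs bs' →
              Push j (q , X) ((p , S) ∷ bs) ((q , X) ∷ bs')

-- Ins i e bs bs' : append e to the set whose pivot range contains e,
-- searching the suffix bs that starts at position i; push if full.
data Ins : ℕ → Key → Heap → Heap → Set where
  ins-here : ∀ {i e p S rest} → Below e rest →
             length (S ++ [ e ]) < 3 * 2 ^ i →
             Ins i e ((p , S) ∷ rest) ((p , S ++ [ e ]) ∷ rest)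
  ins-full : ∀ {i e p S rest rest'} → Below e rest →
             3 * 2 ^ i ≤ length (S ++ [ e ]) →
             Push (suc i) (p , S ++ [ e ]) rest rest' →
             Ins i e ((p , S) ∷ rest) ((p , []) ∷ rest')
  ins-skip : ∀ {i e b rest rest'} → ¬ Below e rest →
             Ins (suc i) e rest rest' →
             Ins i e (b ∷ rest) (b ∷ rest')

-- Filled i bs bs' : ensure S_i (head of bs) is nonempty, pulling if needed.
-- Pull i bs bs'   : pull elements into the empty S_i.
mutual
  data Filled : ℕ → Heap → Heap → Set where
    filled-ne   : ∀ {i p x xs r} → Filled i ((p , x ∷ xs) ∷ r) ((p , x ∷ xs) ∷ r)
    filled-pull : ∀ {i p r bs'} → Pull i ((p , []) ∷ r) bs' → Filled i ((p , []) ∷ r) bs'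

  data Pull : ℕ → Heap → Heap → Set where
    pull-all  : ∀ {i p q T r q' T' r' m} →
                Filled (suc i) ((q , T) ∷ r) ((q' , T') ∷ r') →
                length T' ≤ 2 ^ (i ∸ 1) →
                m ∈ T' → All (_≤ m) T' →
                Pull i ((p , []) ∷ (q , T) ∷ r) ((p , T') ∷ (suc m , []) ∷ r')
    pull-some : ∀ {i p q T r q' T' r' small large m} →
                Filled (suc i) ((q , T) ∷ r) ((q' , T') ∷ r') →
                2 ^ (i ∸ 1) < length T' →
                (small ++ large) ↭ T' →
                length small ≡ 2 ^ (i ∸ 1) →
                All (λ x → All (x <_) large) small →
                m ∈ large → All (m ≤_) large →
                Pull i ((p , []) ∷ (q , T) ∷ r) ((p , small) ∷ (m , large) ∷ r')

mergeLast : Heap → Heap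
mergeLast [] = []
mergeLast (b ∷ []) = b ∷ []
mergeLast ((p , S) ∷ (q , T) ∷ []) = (p , S ++ T) ∷ []
mergeLast (b ∷ c ∷ d ∷ r) = b ∷ mergeLast (c ∷ d ∷ r)

data Shrink : Heap → Heap → Set where
  shrink-yes : ∀ {h} → 2 ≤ numSets h → 1 + ⌊log₂ size h ⌋ < numSets h →
               Shrink h (mergeLast h)
  shrink-no  : ∀ {h} → ¬ (2 ≤ numSets h × 1 + ⌊log₂ size h ⌋ < numSets h) →
               Shrink h h

data DeleteMin : Heap → Heap → Set where
  delmin : ∀ {h p S rest m h'} →
           Filled 1 h ((p , S) ∷ rest) →
           m ∈ S → All (m ≤_) S →
           Shrink ((p , removeK m S) ∷ rest) h' →
           DeleteMin h h'

data Reachable : Heap → Set where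
  r-empty    : Reachable emptyHeap
  r-insert   : ∀ {h h' e} → Reachable h → e ∉ keys h → Ins 1 e h h' → Reachable h'
  r-deletemin : ∀ {h h'} → Reachable h → DeleteMin h h' → Reachable h'
  r-decrease : ∀ {h h' e k} → Reachable h → e ∈ keys h → k < e → k ∉ keys h →
               Ins 1 k (removeKey e h) h' → Reachable h'

-- Keys stay distinct and ℓ ≤ 1 + ⌊lg n⌋ is invariant. A set pushed to S_j has at
-- least 2^(j-1) elements, so when a cascade creates S_(ℓ+1) the heap holds at least
-- 2^ℓ keys and the bound survives the new set. Pulls move keys without changing ℓ;
-- Decrease-Key keeps n because distinct keys make the removal delete exactly one
-- key; Delete-Min lowers n by one, hence ⌊lg n⌋ by at most one, which the single
-- merge of S_(ℓ-1) and S_ℓ repairs.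
module Submission where

open import Defs
open import Data.Nat using (ℕ; _≟_; zero; suc; _+_; _*_; _^_; _≤_; z≤n; s≤s; _≤?_)
open import Data.Nat.Properties
  using (module ≤-Reasoning; ≤-trans; ≤-pred; m≤m+n; m≤n+m; +-suc; +-identityʳ; ≮⇒≥; ≰⇒>; n≤1+n)
open import Data.Nat.Logarithm using (⌊log₂_⌋; ⌊log₂⌋-mono-≤; ⌊log₂[2^n]⌋≡n; ⌊log₂[2*b]⌋≡1+⌊log₂b⌋)
open import Data.List using (List; []; _∷_; _++_; [_]; length)
open import Data.List.Properties using (filter-accept; filter-reject; filter-all; filter-++; length-++; ++-assoc; ++-identityʳ; length-map)
open import Data.List.Membership.Propositional using (_∈_; _∉_)
open import Data.List.Membership.Propositional.Properties using (∈-filter⁻; ∈-++⁺ˡ; ∈-++⁺ʳ)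
open import Data.List.Relation.Unary.Any using (here; there)
open import Data.List.Relation.Unary.All as All using (All; []; _∷_)
open import Data.List.Relation.Unary.All.Properties using (¬Any⇒All¬)
open import Data.List.Relation.Unary.AllPairs using ([]; _∷_)
open import Data.List.Relation.Unary.Unique.Propositional using (Unique)
open import Data.List.Relation.Unary.Unique.Propositional.Properties using (filter⁺)
open import Data.List.Relation.Binary.Permutation.Propositional as ↭ using (_↭_; ↭-sym; ↭-reflexive; ↭⇒↭ₛ)
open import Data.List.Relation.Binary.Permutation.Propositional.Properties using (↭-length; ++⁺ˡ; ++⁺ʳ; shift)
import Data.List.Relation.Binary.Permutation.Setoid.Properties as ↭ₛ
open import Data.Product using (_,_; proj₁; proj₂)
open import Function using (_∘_)
open import Relation.Nullary using (¬_; ¬?; Dec; yes; no)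
open import Relation.Binary.PropositionalEquality using (_≡_; refl; sym; trans; cong; subst; setoid)

2^m≤n⇒m≤⌊log₂n⌋ : ∀ m n → 2 ^ m ≤ n → m ≤ ⌊log₂ n ⌋
2^m≤n⇒m≤⌊log₂n⌋ m n le = subst (_≤ ⌊log₂ n ⌋) (⌊log₂[2^n]⌋≡n m) (⌊log₂⌋-mono-≤ le)

⌊log₂[1+n]⌋≤1+⌊log₂n⌋ : ∀ n → ⌊log₂ suc n ⌋ ≤ 1 + ⌊log₂ n ⌋
⌊log₂[1+n]⌋≤1+⌊log₂n⌋ zero = z≤n
⌊log₂[1+n]⌋≤1+⌊log₂n⌋ (suc n) =
  subst (⌊log₂ suc (suc n) ⌋ ≤_) (⌊log₂[2*b]⌋≡1+⌊log₂b⌋ (suc n)) (⌊log₂⌋-mono-≤ 2+n≤2*[1+n])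
  where
  2+n≤2*[1+n] : suc (suc n) ≤ 2 * suc n
  2+n≤2*[1+n] = s≤s (subst (suc n ≤_) (sym (+-suc n (n + 0))) (s≤s (m≤m+n n (n + 0))))

≢? : (e x : Key) → Dec (¬ x ≡ e)
≢? e x = ¬? (x ≟ e)

Unique-resp-↭ : ∀ {xs ys : List Key} → xs ↭ ys → Unique xs → Unique ys
Unique-resp-↭ p = ↭ₛ.Unique-resp-↭ (setoid Key) (↭⇒↭ₛ p)

Unique-++⇒∉ʳ : ∀ {x : Key} xs {ys} → Unique (xs ++ ys) → x ∈ xs → x ∉ ys
Unique-++⇒∉ʳ (_ ∷ xs) (x≢xs++ys ∷ _) (here refl) x∈ys = All.lookup x≢xs++ys (∈-++⁺ʳ xs x∈ys) refl
Unique-++⇒∉ʳ (_ ∷ xs) (_ ∷ u) (there x∈xs) = Unique-++⇒∉ʳ xs u x∈xs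

removeK-∉ : ∀ {e xs} → e ∉ xs → removeK e xs ≡ xs
removeK-∉ {e} {xs} e∉ = filter-all (≢? e) (All.map (_∘ sym) (¬Any⇒All¬ xs e∉))

length-removeK : ∀ {e xs} → Unique xs → e ∈ xs → suc (length (removeK e xs)) ≡ length xs
length-removeK {xs = x ∷ xs} (x≢xs ∷ _) (here refl) =
  cong (suc ∘ length) (trans (filter-reject (≢? x) (λ x≢x → x≢x refl)) (removeK-∉ x∉xs))
  where
  x∉xs : x ∉ xs
  x∉xs x∈xs = All.lookup x≢xs x∈xs refl
length-removeK {e} (x≢xs ∷ u) (there e∈xs) =
  trans (cong (suc ∘ length) (filter-accept (≢? e) (All.lookup x≢xs e∈xs))) (cong suc (length-removeK u e∈xs))

removeK-++ˡ : ∀ {e} xs {ys} → Unique (xs ++ ys) → e ∈ xs → removeK e (xs ++ ys) ≡ removeK e xs ++ ys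
removeK-++ˡ {e} xs {ys} u e∈xs =
  trans (filter-++ (≢? e) xs ys) (cong (removeK e xs ++_) (removeK-∉ (Unique-++⇒∉ʳ xs u e∈xs)))

keys-removeKey : ∀ e h → keys (removeKey e h) ≡ removeK e (keys h)
keys-removeKey e [] = refl
keys-removeKey e ((_ , S) ∷ h) =
  trans (cong (removeK e S ++_) (keys-removeKey e h)) (sym (filter-++ (≢? e) S (keys h)))

push-keys : ∀ {j X bs bs'} → Push j X bs bs' → keys bs' ↭ proj₂ X ++ keys bs
push-keys push-new = ↭.refl
push-keys (push-cat {X = X} {S = S} {bs = bs} _) = ↭-reflexive (++-assoc X S (keys bs))
push-keys (push-casc {X = X} _ p) = ++⁺ˡ X (push-keys p)

append-↭ : ∀ (e : Key) S R → (S ++ [ e ]) ++ R ↭ e ∷ S ++ R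
append-↭ e S R = ↭.trans (↭-reflexive (++-assoc S [ e ] R)) (shift e S R)

ins-keys : ∀ {i e bs bs'} → Ins i e bs bs' → keys bs' ↭ e ∷ keys bs
ins-keys (ins-here {e = e} {S = S} {rest = rest} _ _) = append-↭ e S (keys rest)
ins-keys (ins-full {e = e} {S = S} {rest = rest} _ _ p) = ↭.trans (push-keys p) (append-↭ e S (keys rest))
ins-keys (ins-skip {e = e} {b = (_ , S)} {rest = rest} _ q) = ↭.trans (++⁺ˡ S (ins-keys q)) (shift e S (keys rest))

mutual
  filled-keys : ∀ {i bs bs'} → Filled i bs bs' → keys bs' ↭ keys bs
  filled-keys filled-ne = ↭.refl
  filled-keys (filled-pull p) = pull-keys p

  pull-keys : ∀ {i bs bs'} → Pull i bs bs' → keys bs' ↭ keys bs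
  pull-keys (pull-all f _ _ _) = filled-keys f
  pull-keys (pull-some {r' = r'} {small = small} {large = large} f _ perm _ _ _ _) =
    ↭.trans (↭-reflexive (sym (++-assoc small large (keys r')))) (↭.trans (++⁺ʳ (keys r') perm) (filled-keys f))

mutual
  filled-numSets : ∀ {i bs bs'} → Filled i bs bs' → numSets bs' ≡ numSets bs
  filled-numSets filled-ne = refl
  filled-numSets (filled-pull p) = pull-numSets p

  pull-numSets : ∀ {i bs bs'} → Pull i bs bs' → numSets bs' ≡ numSets bs
  pull-numSets (pull-all f _ _ _) = cong suc (filled-numSets f)
  pull-numSets (pull-some f _ _ _ _ _ _) = cong suc (filled-numSets f)

keys-mergeLast : ∀ h → keys (mergeLast h) ≡ keys h
keys-mergeLast [] = refl
keys-mergeLast (_ ∷ []) = refl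
keys-mergeLast ((_ , S) ∷ (_ , T) ∷ []) = ++-assoc S T []
keys-mergeLast ((_ , S) ∷ c ∷ d ∷ r) = cong (S ++_) (keys-mergeLast (c ∷ d ∷ r))

numSets-mergeLast : ∀ h → 2 ≤ numSets h → suc (numSets (mergeLast h)) ≡ numSets h
numSets-mergeLast (_ ∷ []) (s≤s ())
numSets-mergeLast (_ ∷ _ ∷ []) _ = refl
numSets-mergeLast (b ∷ c ∷ d ∷ r) _ = cong suc (numSets-mergeLast (c ∷ d ∷ r) (s≤s (s≤s z≤n)))

-- Growth k bs bs' describes the suffix bs, starting at S_(k+1), of a heap with
-- ℓ = k + numSets bs sets: either ℓ is unchanged, or S_(ℓ+1) was created and the
-- suffix now holds at least 2^ℓ keys.
data Growth (k : ℕ) (bs bs' : Heap) : Set where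
  same-numSets : numSets bs' ≡ numSets bs → Growth k bs bs'
  new-set      : numSets bs' ≡ suc (numSets bs) → 2 ^ (k + numSets bs) ≤ size bs' → Growth k bs bs'

growth-∷ : ∀ {k b b' bs bs'} → Growth (suc k) bs bs' → Growth k (b ∷ bs) (b' ∷ bs')
growth-∷ (same-numSets eq) = same-numSets (cong suc eq)
growth-∷ {k} {b' = (_ , S)} {bs} {bs'} (new-set eq big) = new-set (cong suc eq) bound
  where
  bound : 2 ^ (k + suc (numSets bs)) ≤ length (S ++ keys bs')
  bound rewrite +-suc k (numSets bs) | length-++ S {keys bs'} = ≤-trans big (m≤n+m _ _)

push-growth : ∀ {k X bs bs'} → Push (suc k) X bs bs' → 2 ^ k ≤ length (proj₂ X) → Growth k bs bs'
push-growth {k} {X = (_ , X)} push-new big = new-set refl bound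
  where
  bound : 2 ^ (k + 0) ≤ length (X ++ [])
  bound rewrite +-identityʳ k | ++-identityʳ X = big
push-growth (push-cat _) _ = same-numSets refl
push-growth (push-casc full p) _ = growth-∷ (push-growth p full)

ins-growth : ∀ {k e bs bs'} → Ins (suc k) e bs bs' → Growth k bs bs'
ins-growth (ins-here _ _) = same-numSets refl
ins-growth (ins-full _ full p) = growth-∷ (push-growth p (≤-trans (m≤m+n _ _) full))
ins-growth (ins-skip _ q) = growth-∷ (ins-growth q)

growth-bound : ∀ {g h'} → Growth 0 g h' → numSets g ≤ 1 + ⌊log₂ size h' ⌋ → numSets h' ≤ 1 + ⌊log₂ size h' ⌋
growth-bound {h' = h'} (same-numSets eq) le = subst (_≤ 1 + ⌊log₂ size h' ⌋) (sym eq) le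
growth-bound {g} {h'} (new-set eq big) _ =
  subst (_≤ 1 + ⌊log₂ size h' ⌋) (sym eq) (s≤s (2^m≤n⇒m≤⌊log₂n⌋ (numSets g) (size h') big))

shrink-keys : ∀ {g h'} → Shrink g h' → keys h' ≡ keys g
shrink-keys (shrink-yes {h = g} _ _) = keys-mergeLast g
shrink-keys (shrink-no _) = refl

shrink-bound : ∀ {g h'} → numSets g ≤ 2 + ⌊log₂ size g ⌋ → Shrink g h' → numSets h' ≤ 1 + ⌊log₂ size h' ⌋
shrink-bound {g} le (shrink-yes two _) rewrite keys-mergeLast g =
  ≤-pred (subst (_≤ 2 + ⌊log₂ size g ⌋) (sym (numSets-mergeLast g two)) le)
shrink-bound {g} _ (shrink-no not-both) with 2 ≤? numSets g
... | no  ≱2 = ≤-trans (≤-pred (≰⇒> ≱2)) (s≤s z≤n)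
... | yes ≥2 = ≮⇒≥ (λ too-many → not-both (≥2 , too-many))

record Invariant (h : Heap) : Set where
  field
    keys-unique   : Unique (keys h)
    numSets-bound : numSets h ≤ 1 + ⌊log₂ size h ⌋

size-ins : ∀ {i e g h'} → Ins i e g h' → size h' ≡ suc (size g)
size-ins ins = ↭-length (ins-keys ins)

ins-invariant : ∀ {e g h'} → Unique (keys g) → e ∉ keys g →
                numSets g ≤ 1 + ⌊log₂ size h' ⌋ → Ins 1 e g h' → Invariant h'
ins-invariant {g = g} u e∉ le ins = record
  { keys-unique   = Unique-resp-↭ (↭-sym (ins-keys ins)) (¬Any⇒All¬ (keys g) e∉ ∷ u)
  ; numSets-bound = growth-bound (ins-growth ins) le
  }

insert-invariant : ∀ {e g h'} → Invariant g → e ∉ keys g → Ins 1 e g h' → Invariant h'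
insert-invariant {g = g} {h'} inv e∉ ins =
  ins-invariant keys-unique e∉ (≤-trans numSets-bound (s≤s (⌊log₂⌋-mono-≤ size-grows))) ins
  where
  open Invariant inv
  size-grows : size g ≤ size h'
  size-grows = subst (size g ≤_) (sym (size-ins ins)) (n≤1+n (size g))

decreaseKey-invariant : ∀ {e k h h'} → Invariant h → e ∈ keys h → k ∉ keys h →
                        Ins 1 k (removeKey e h) h' → Invariant h'
decreaseKey-invariant {e} {k} {h} {h'} inv e∈ k∉ ins = ins-invariant unique k∉g bound ins
  where
  open ≤-Reasoning
  open Invariant inv
  g = removeKey e h
  unique : Unique (keys g)
  unique = subst Unique (sym (keys-removeKey e h)) (filter⁺ (≢? e) keys-unique)
  k∉g : k ∉ keys g
  k∉g k∈g = k∉ (proj₁ (∈-filter⁻ (≢? e) (subst (k ∈_) (keys-removeKey e h) k∈g)))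
  same-size : size h' ≡ size h
  same-size = begin-equality
    size h'                             ≡⟨ size-ins ins ⟩
    suc (length (keys g))               ≡⟨ cong (suc ∘ length) (keys-removeKey e h) ⟩
    suc (length (removeK e (keys h)))   ≡⟨ length-removeK keys-unique e∈ ⟩
    size h                              ∎
  bound : numSets g ≤ 1 + ⌊log₂ size h' ⌋
  bound = begin
    numSets g                ≡⟨ length-map _ h ⟩
    numSets h                ≤⟨ numSets-bound ⟩
    1 + ⌊log₂ size h ⌋       ≡⟨ cong (λ n → 1 + ⌊log₂ n ⌋) (sym same-size) ⟩
    1 + ⌊log₂ size h' ⌋      ∎

deleteMin-invariant : ∀ {h h'} → Invariant h → DeleteMin h h' → Invariant h'
deleteMin-invariant {h} inv (delmin {p = p} {S} {rest} {m} filled m∈S _ shrink) = record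
  { keys-unique   = subst Unique (sym (shrink-keys shrink)) unique
  ; numSets-bound = shrink-bound bound shrink
  }
  where
  open ≤-Reasoning
  open Invariant inv
  g = (p , removeK m S) ∷ rest
  filled-unique : Unique (S ++ keys rest)
  filled-unique = Unique-resp-↭ (↭-sym (filled-keys filled)) keys-unique
  keys-g : keys g ≡ removeK m (S ++ keys rest)
  keys-g = sym (removeK-++ˡ S filled-unique m∈S)
  unique : Unique (keys g)
  unique = subst Unique (sym keys-g) (filter⁺ (≢? m) filled-unique)
  size-drops : suc (size g) ≡ size h
  size-drops = begin-equality
    suc (length (keys g))                     ≡⟨ cong (suc ∘ length) keys-g ⟩
    suc (length (removeK m (S ++ keys rest))) ≡⟨ length-removeK filled-unique (∈-++⁺ˡ m∈S) ⟩
    length (S ++ keys rest)                   ≡⟨ ↭-length (filled-keys filled) ⟩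
    size h                                    ∎
  bound : numSets g ≤ 2 + ⌊log₂ size g ⌋
  bound = begin
    numSets g                    ≡⟨ filled-numSets filled ⟩
    numSets h                    ≤⟨ numSets-bound ⟩
    1 + ⌊log₂ size h ⌋           ≡⟨ cong (λ n → 1 + ⌊log₂ n ⌋) (sym size-drops) ⟩
    1 + ⌊log₂ suc (size g) ⌋     ≤⟨ s≤s (⌊log₂[1+n]⌋≤1+⌊log₂n⌋ (size g)) ⟩
    2 + ⌊log₂ size g ⌋           ∎

reachable⇒invariant : ∀ {h} → Reachable h → Invariant h
reachable⇒invariant r-empty = record { keys-unique = [] ; numSets-bound = s≤s z≤n }
reachable⇒invariant (r-insert r e∉ ins) = insert-invariant (reachable⇒invariant r) e∉ ins
reachable⇒invariant (r-deletemin r del) = deleteMin-invariant (reachable⇒invariant r) del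
reachable⇒invariant (r-decrease r e∈ _ k∉ ins) = decreaseKey-invariant (reachable⇒invariant r) e∈ k∉ ins

lemma11 : (h : Heap) → Reachable h → 1 ≤ size h →
          numSets h ≤ 1 + ⌊log₂ size h ⌋
lemma11 _ r _ = Invariant.numSets-bound (reachable⇒invariant r)
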